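{- Let $G$ be a finite simple connected undirected graph on vertex set $V=\{1,\dots,n\}$ with $m$ edges, every vertex of degree at least $2$. For every integer $k\ge 0$, \[ \tilde P^{(k+1)} = D^{ -1}TP_{nb}^{k}S = D^{ -1}TP_{nb}^{k+1}T^{\top}, \] where $P_{nb}^0=I$.
   Context: $d_i=\deg(i)$ and $D=\mathrm{diag}(d_1,\dots,d_n)$. The set $\hat E$ of directed edges consists of the $2m$ ordered pairs $(i,j)$ with $\{i,j\}$ an edge of $G$. $P_{nb}$ is the $2m\times 2m$ matrix indexed by $\hat E$ with $P_{nb}((i,j),(k,\ell))=\frac{1}{d_j-1}$ if $j=k$ and $\ell\ne i$, and $0$ otherwise. $S$ is the $2m\times n$ matrix with $S((i,j),x)=1$ if $j=x$ and $0$ otherwise; $T$ is the $n\times 2m$ matrix with $T(x,(i,j))=1$ if $i=x$ and $0$ otherwise. The non-backtracking random walk (NBRW) on the vertices is the process $(\tilde X_k)_{k\ge0}$ in which $\tilde X_1$ is a uniformly random neighbor of $\tilde X_0$ and, for $k\ge1$, $\tilde X_{k+1}$ is chosen uniformly at random among the neighbors of $\tilde X_k$ other than $\tilde X_{k-1}$. $\tilde P^{(k)}$ is the $n\times n$ matrix with $\tilde P^{(k)}_{ij}=\mathbb P(\tilde X_k=j\mid \tilde X_0=i)$. -}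

module Defs where

open import Data.Bool using (Bool; true; false; if_then_else_; _∧_; not; T)
open import Data.Nat as ℕ using (ℕ; zero; suc; _≤_)
open import Data.Integer using (+_)
open import Data.Rational using (ℚ; 0ℚ; 1ℚ; _+_; _*_; _/_)
open import Data.Fin using (Fin; zero; suc; _≟_)
open import Data.Vec using (Vec; []; _∷_; last)
open import Data.Product using (Σ; Σ-syntax; _,_; proj₁; proj₂)
open import Data.Unit using (tt)
open import Relation.Nullary.Decidable using (⌊_⌋)
open import Relation.Binary.PropositionalEquality using (_≡_)

record Graph (n : ℕ) : Set where
  field
    adj     : Fin n → Fin n → Bool
    symm    : ∀ i j → adj i j ≡ adj j i
    irrefl  : ∀ i → adj i i ≡ false

module _ {n : ℕ} (G : Graph n) where
  open Graph G

  data Reach : Fin n → Fin n → Set where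
    here : ∀ {i} → Reach i i
    step : ∀ {i j k} → T (adj i j) → Reach j k → Reach i k

  Connected : Set
  Connected = ∀ i j → Reach i j

sumFin : (k : ℕ) → (Fin k → ℚ) → ℚ
sumFin zero    f = 0ℚ
sumFin (suc k) f = f zero + sumFin k (λ i → f (suc i))

countFin : (k : ℕ) → (Fin k → Bool) → ℕ
countFin zero    f = zero
countFin (suc k) f = (if f zero then 1 else 0) ℕ.+ countFin k (λ i → f (suc i))

sumVec : (n k : ℕ) → (Vec (Fin n) k → ℚ) → ℚ
sumVec n zero    f = f []
sumVec n (suc k) f = sumFin n (λ x → sumVec n k (λ xs → f (x ∷ xs)))

-- 1/a as a rational, with the convention inv 0 = 0 (never used: degrees are ≥ 2)
inv : ℕ → ℚ
inv zero    = 0ℚ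
inv (suc k) = + 1 / suc k

ind : Bool → ℚ
ind true  = 1ℚ
ind false = 0ℚ

eqF : ∀ {n} → Fin n → Fin n → Bool
eqF i j = ⌊ i ≟ j ⌋

sumIf : (b : Bool) → (T b → ℚ) → ℚ
sumIf true  f = f tt
sumIf false f = 0ℚ

module GraphMatrices {n : ℕ} (G : Graph n) where
  open Graph G

  deg : Fin n → ℕ
  deg i = countFin n (adj i)

  Ê : Set
  Ê = Σ[ i ∈ Fin n ] Σ[ j ∈ Fin n ] T (adj i j)

  src tgt : Ê → Fin n
  src e = proj₁ e
  tgt e = proj₁ (proj₂ e)

  sumÊ : (Ê → ℚ) → ℚ
  sumÊ f = sumFin n (λ i → sumFin n (λ j → sumIf (adj i j) (λ p → f (i , j , p))))

  Mat : Set → Set → Set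
  Mat A B = A → B → ℚ

  mul : ∀ {A B C : Set} → ((B → ℚ) → ℚ) → Mat A B → Mat B C → Mat A C
  mul sumB M N a c = sumB (λ b → M a b * N b c)

  _·V_ : ∀ {A C : Set} → Mat A (Fin n) → Mat (Fin n) C → Mat A C
  M ·V N = mul (sumFin n) M N

  _·E_ : ∀ {A C : Set} → Mat A Ê → Mat Ê C → Mat A C
  M ·E N = mul sumÊ M N

  infixl 7 _·V_ _·E_

  Dinv : Mat (Fin n) (Fin n)
  Dinv x y = ind (eqF x y) * inv (deg x)

  Pnb : Mat Ê Ê
  Pnb e f = ind (eqF (tgt e) (src f) ∧ not (eqF (tgt f) (src e)))
            * inv (deg (tgt e) ℕ.∸ 1)

  IÊ : Mat Ê Ê
  IÊ e f = ind (eqF (src e) (src f) ∧ eqF (tgt e) (tgt f))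

  Pnb^ : ℕ → Mat Ê Ê
  Pnb^ zero    = IÊ
  Pnb^ (suc k) = Pnb^ k ·E Pnb

  S : Mat Ê (Fin n)
  S e x = ind (eqF (tgt e) x)

  Tm : Mat (Fin n) Ê
  Tm x e = ind (eqF (src e) x)

  Tᵀ : Mat Ê (Fin n)
  Tᵀ e x = Tm x e

  -- Conditional probability of the steps x₁ x₂ … given previous vertex
  -- `prev` and current vertex `cur`: each step picks uniformly among the
  -- neighbours of the current vertex other than the previous one.
  nbProb : ∀ {k} → Fin n → Fin n → Vec (Fin n) k → ℚ
  nbProb prev cur []       = 1ℚ
  nbProb prev cur (y ∷ ys) =
    ind (adj cur y ∧ not (eqF y prev)) * inv (deg cur ℕ.∸ 1) * nbProb cur y ys

  -- Probability that (X̃₁ , … , X̃ₖ₊₁) = (x ∷ xs) given X̃₀ = i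
  -- (first step uniform among neighbours of i).
  pathProb : ∀ {k} → Fin n → Vec (Fin n) (suc k) → ℚ
  pathProb i (x ∷ xs) = ind (adj i x) * inv (deg i) * nbProb i x xs

  P̃ : ℕ → Mat (Fin n) (Fin n)
  P̃ zero    i j = ind (eqF i j)
  P̃ (suc k) i j = sumVec n (suc k) (λ xs → ind (eqF (last xs) j) * pathProb i xs)

-- From the directed edge (a , b) the non-backtracking walk moves to an edge
-- (b , y) with y ≠ a, each with probability 1/(d_b − 1): the transition law
-- on directed edges is exactly P_nb.  So the probability of sitting at j
-- after k further steps from (a , b) is (P_nb^k S)((a , b) , j), and
-- averaging over the uniform first step (the row of D⁻¹T at i) gives
-- P̃^(k+1) = D⁻¹ T P_nb^k S.  The second identity is P_nb Tᵀ = S: the row of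
-- P_nb at (a , b) has d_b − 1 entries 1/(d_b − 1), all on edges leaving b,
-- which is where d_b ≥ 2 is needed.
module Submission where

open import Algebra.Bundles using (CommutativeMonoid)
open import Data.Bool using (Bool; true; false; _∧_; not; T; if_then_else_)
open import Data.Bool.Properties using (∧-identityʳ)
open import Data.Empty using (⊥-elim)
open import Data.Fin using (Fin; zero; suc; _≟_)
open import Data.Integer as ℤ using ()
import Data.Integer.Properties as ℤ
open import Data.Nat as ℕ using (ℕ; zero; suc; _≤_; _∸_; s≤s; z≤n)
open import Data.Nat.Properties using (+-suc)
open import Data.Product using (_×_; _,_; Σ-syntax)
open import Data.Rational using (ℚ; 0ℚ; 1ℚ; _+_; _*_; _/_; toℚᵘ)
open import Data.Rational.Properties
  using ( +-identityˡ; +-identityʳ; *-assoc; *-comm; *-identityˡ; *-identityʳ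
        ; *-zeroˡ; *-zeroʳ; *-distribˡ-+; toℚᵘ-injective; toℚᵘ-fromℚᵘ
        ; toℚᵘ-homo-+; toℚᵘ-homo-*; +-0-commutativeMonoid; *-1-commutativeMonoid)
open import Data.Rational.Unnormalised as ℚᵘ using (mkℚᵘ; *≡*)
import Data.Rational.Unnormalised.Properties as ℚᵘ
open import Data.Unit using (tt)
open import Data.Vec using ([]; _∷_; last)
open import Relation.Binary.PropositionalEquality
open import Relation.Nullary using (yes; no)
open import Defs

open import Algebra.Properties.CommutativeSemigroup
  (CommutativeMonoid.commutativeSemigroup +-0-commutativeMonoid) using (interchange)
open import Algebra.Properties.CommutativeSemigroup
  (CommutativeMonoid.commutativeSemigroup *-1-commutativeMonoid) using (x∙yz≈y∙xz)

fromℕ : ℕ → ℚ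
fromℕ m = ℤ.+ m / 1

fromℕ-+ : ∀ a b → fromℕ (a ℕ.+ b) ≡ fromℕ a + fromℕ b
fromℕ-+ a b = toℚᵘ-injective (begin
  toℚᵘ (fromℕ (a ℕ.+ b))              ≈⟨ toℚᵘ-fromℚᵘ (mkℚᵘ (ℤ.+ (a ℕ.+ b)) 0) ⟩
  mkℚᵘ (ℤ.+ (a ℕ.+ b)) 0              ≈⟨ *≡* (cong (ℤ._* ℤ.+ 1) (sym (cong₂ ℤ._+_ (ℤ.*-identityʳ (ℤ.+ a)) (ℤ.*-identityʳ (ℤ.+ b))))) ⟩
  mkℚᵘ (ℤ.+ a) 0 ℚᵘ.+ mkℚᵘ (ℤ.+ b) 0  ≈⟨ ℚᵘ.+-cong (ℚᵘ.≃-sym (toℚᵘ-fromℚᵘ (mkℚᵘ (ℤ.+ a) 0))) (ℚᵘ.≃-sym (toℚᵘ-fromℚᵘ (mkℚᵘ (ℤ.+ b) 0))) ⟩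
  toℚᵘ (fromℕ a) ℚᵘ.+ toℚᵘ (fromℕ b)  ≈⟨ ℚᵘ.≃-sym (toℚᵘ-homo-+ (fromℕ a) (fromℕ b)) ⟩
  toℚᵘ (fromℕ a + fromℕ b)            ∎)
  where open ℚᵘ.≃-Reasoning

fromℕ-*-inv : ∀ m → fromℕ (suc m) * inv (suc m) ≡ 1ℚ
fromℕ-*-inv m = toℚᵘ-injective (begin
  toℚᵘ (fromℕ (suc m) * inv (suc m))            ≈⟨ toℚᵘ-homo-* (fromℕ (suc m)) (inv (suc m)) ⟩
  toℚᵘ (fromℕ (suc m)) ℚᵘ.* toℚᵘ (inv (suc m))  ≈⟨ ℚᵘ.*-cong (toℚᵘ-fromℚᵘ (mkℚᵘ (ℤ.+ suc m) 0)) (toℚᵘ-fromℚᵘ (mkℚᵘ (ℤ.+ 1) m)) ⟩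
  mkℚᵘ (ℤ.+ suc m) 0 ℚᵘ.* mkℚᵘ (ℤ.+ 1) m        ≈⟨ ℚᵘ.*-inverseʳ (mkℚᵘ (ℤ.+ suc m) 0) ⟩
  ℚᵘ.1ℚᵘ                                        ∎)
  where open ℚᵘ.≃-Reasoning

fromℕ-pred-*-inv : ∀ {d} → 2 ≤ d → fromℕ (d ∸ 1) * inv (d ∸ 1) ≡ 1ℚ
fromℕ-pred-*-inv (s≤s (s≤s {n = m} z≤n)) = fromℕ-*-inv m

open ≡-Reasoning

record Linear {A : Set} (σ : (A → ℚ) → ℚ) : Set where
  field
    sum-cong : ∀ {f g} → (∀ a → f a ≡ g a) → σ f ≡ σ g
    sum-+    : ∀ f g → σ (λ a → f a + g a) ≡ σ f + σ g
    sum-*ˡ   : ∀ c f → σ (λ a → c * f a) ≡ c * σ f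

  sum-0 : σ (λ _ → 0ℚ) ≡ 0ℚ
  sum-0 = begin
    σ (λ _ → 0ℚ)       ≡⟨ sum-cong (λ _ → sym (*-zeroˡ 0ℚ)) ⟩
    σ (λ _ → 0ℚ * 0ℚ)  ≡⟨ sum-*ˡ 0ℚ (λ _ → 0ℚ) ⟩
    0ℚ * σ (λ _ → 0ℚ)  ≡⟨ *-zeroˡ (σ (λ _ → 0ℚ)) ⟩
    0ℚ                 ∎

  sum-*ʳ : ∀ c f → σ (λ a → f a * c) ≡ σ f * c
  sum-*ʳ c f = begin
    σ (λ a → f a * c)  ≡⟨ sum-cong (λ a → *-comm (f a) c) ⟩
    σ (λ a → c * f a)  ≡⟨ sum-*ˡ c f ⟩
    c * σ f            ≡⟨ *-comm c (σ f) ⟩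
    σ f * c            ∎

open Linear

Interchangeable : {A : Set} → ((A → ℚ) → ℚ) → Set₁
Interchangeable {A} σ = ∀ {B : Set} (τ : (B → ℚ) → ℚ) → Linear τ → (f : A → B → ℚ) →
  σ (λ a → τ (f a)) ≡ τ (λ b → σ (λ a → f a b))

sumFin-linear : ∀ k → Linear (sumFin k)
sumFin-linear k = record { sum-cong = congᶠ k ; sum-+ = sumᶠ-+ k ; sum-*ˡ = sumᶠ-*ˡ k }
  where
  congᶠ : ∀ k {f g} → (∀ a → f a ≡ g a) → sumFin k f ≡ sumFin k g
  congᶠ zero    f≗g = refl
  congᶠ (suc k) f≗g = cong₂ _+_ (f≗g zero) (congᶠ k (λ a → f≗g (suc a)))

  sumᶠ-+ : ∀ k f g → sumFin k (λ a → f a + g a) ≡ sumFin k f + sumFin k g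
  sumᶠ-+ zero    f g = sym (+-identityˡ 0ℚ)
  sumᶠ-+ (suc k) f g = trans (cong (f zero + g zero +_) (sumᶠ-+ k _ _))
                             (interchange (f zero) (g zero) _ _)

  sumᶠ-*ˡ : ∀ k c f → sumFin k (λ a → c * f a) ≡ c * sumFin k f
  sumᶠ-*ˡ zero    c f = sym (*-zeroʳ c)
  sumᶠ-*ˡ (suc k) c f = trans (cong (c * f zero +_) (sumᶠ-*ˡ k c _))
                              (sym (*-distribˡ-+ c _ _))

sumIf-linear : ∀ b → Linear (sumIf b)
sumIf-linear true  = record
  { sum-cong = λ f≗g → f≗g tt ; sum-+ = λ _ _ → refl ; sum-*ˡ = λ _ _ → refl }
sumIf-linear false = record
  { sum-cong = λ _ → refl
  ; sum-+ = λ _ _ → sym (+-identityˡ 0ℚ)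
  ; sum-*ˡ = λ c _ → sym (*-zeroʳ c)
  }

sumFin-interchange : ∀ k → Interchangeable (sumFin k)
sumFin-interchange zero    τ L f = sym (sum-0 L)
sumFin-interchange (suc k) τ L f =
  trans (cong (τ (f zero) +_) (sumFin-interchange k τ L (λ a → f (suc a))))
        (sym (sum-+ L _ _))

sumIf-interchange : ∀ b → Interchangeable (sumIf b)
sumIf-interchange true  τ L f = refl
sumIf-interchange false τ L f = sym (sum-0 L)

nestedSum : ∀ {A C : Set} {B : A → Set} →
  ((A → ℚ) → ℚ) → (∀ a → (B a → ℚ) → ℚ) → (∀ a → B a → C) → (C → ℚ) → ℚ
nestedSum σ τ pair f = σ (λ a → τ a (λ b → f (pair a b)))

nestedSum-linear : ∀ {A C : Set} {B : A → Set} {σ : (A → ℚ) → ℚ} {τ : ∀ a → (B a → ℚ) → ℚ}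
  (pair : ∀ a → B a → C) → Linear σ → (∀ a → Linear (τ a)) → Linear (nestedSum σ τ pair)
nestedSum-linear pair Lσ Lτ = record
  { sum-cong = λ f≗g → sum-cong Lσ (λ a → sum-cong (Lτ a) (λ b → f≗g (pair a b)))
  ; sum-+    = λ f g → trans (sum-cong Lσ (λ a → sum-+ (Lτ a) _ _)) (sum-+ Lσ _ _)
  ; sum-*ˡ   = λ c f → trans (sum-cong Lσ (λ a → sum-*ˡ (Lτ a) c _)) (sum-*ˡ Lσ c _)
  }

nestedSum-interchange : ∀ {A C : Set} {B : A → Set} {σ : (A → ℚ) → ℚ} {τ : ∀ a → (B a → ℚ) → ℚ}
  (pair : ∀ a → B a → C) → Linear σ → Interchangeable σ → (∀ a → Interchangeable (τ a)) →
  Interchangeable (nestedSum σ τ pair)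
nestedSum-interchange pair Lσ swapσ swapτ ρ Lρ f =
  trans (sum-cong Lσ (λ a → swapτ a ρ Lρ _)) (swapσ ρ Lρ _)

sumVec-linear : ∀ n k → Linear (sumVec n k)
sumVec-linear n zero    = record
  { sum-cong = λ f≗g → f≗g [] ; sum-+ = λ _ _ → refl ; sum-*ˡ = λ _ _ → refl }
sumVec-linear n (suc k) = nestedSum-linear _∷_ (sumFin-linear n) (λ _ → sumVec-linear n k)

product-assoc : ∀ {A B C D : Set} {σB : (B → ℚ) → ℚ} {σC : (C → ℚ) → ℚ} →
  Linear σB → Linear σC → Interchangeable σC →
  (M : A → B → ℚ) (N : B → C → ℚ) (L : C → D → ℚ) → ∀ a d →
  σC (λ c → σB (λ b → M a b * N b c) * L c d) ≡ σB (λ b → M a b * σC (λ c → N b c * L c d))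
product-assoc {σB = σB} {σC} LB LC swapC M N L a d = begin
  σC (λ c → σB (λ b → M a b * N b c) * L c d)    ≡⟨ sum-cong LC (λ c → sym (sum-*ʳ LB (L c d) _)) ⟩
  σC (λ c → σB (λ b → M a b * N b c * L c d))    ≡⟨ swapC σB LB _ ⟩
  σB (λ b → σC (λ c → M a b * N b c * L c d))    ≡⟨ sum-cong LB (λ b → sum-cong LC (λ c → *-assoc (M a b) _ _)) ⟩
  σB (λ b → σC (λ c → M a b * (N b c * L c d)))  ≡⟨ sum-cong LB (λ b → sum-*ˡ LC (M a b) _) ⟩
  σB (λ b → M a b * σC (λ c → N b c * L c d))    ∎

ind-∧ : ∀ u v → ind (u ∧ v) ≡ ind u * ind v
ind-∧ true  v = sym (*-identityˡ (ind v))
ind-∧ false v = sym (*-zeroˡ (ind v))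

sumIf-const : ∀ b c → sumIf b (λ _ → c) ≡ ind b * c
sumIf-const true  c = sym (*-identityˡ c)
sumIf-const false c = sym (*-zeroˡ c)

sumIf-at : ∀ b (p : T b) f → sumIf b f ≡ f p
sumIf-at true tt f = refl

sumIf-weight : ∀ b u c w → sumIf b (λ _ → ind u * (c * w)) ≡ ind (b ∧ u) * c * w
sumIf-weight b u c w = begin
  sumIf b (λ _ → ind u * (c * w))  ≡⟨ sumIf-const b _ ⟩
  ind b * (ind u * (c * w))        ≡⟨ cong (ind b *_) (sym (*-assoc (ind u) c w)) ⟩
  ind b * (ind u * c * w)          ≡⟨ sym (*-assoc (ind b) _ w) ⟩
  ind b * (ind u * c) * w          ≡⟨ cong (_* w) (sym (*-assoc (ind b) (ind u) c)) ⟩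
  ind b * ind u * c * w            ≡⟨ cong (λ z → z * c * w) (sym (ind-∧ b u)) ⟩
  ind (b ∧ u) * c * w              ∎

eqF-sym : ∀ {k} (x y : Fin k) → eqF x y ≡ eqF y x
eqF-sym x y with x ≟ y | y ≟ x
... | yes _   | yes _   = refl
... | no _    | no _    = refl
... | yes x≡y | no y≢x  = ⊥-elim (y≢x (sym x≡y))
... | no x≢y  | yes y≡x = ⊥-elim (x≢y (sym y≡x))

eqF-suc : ∀ {k} (x y : Fin k) → eqF (suc x) (suc y) ≡ eqF x y
eqF-suc x y with x ≟ y
... | yes _ = refl
... | no _  = refl

sumFin-δ : ∀ k (j : Fin k) f → sumFin k (λ x → ind (eqF j x) * f x) ≡ f j
sumFin-δ (suc k) zero f = begin
  1ℚ * f zero + sumFin k (λ x → 0ℚ * f (suc x))  ≡⟨ cong₂ _+_ (*-identityˡ (f zero)) rest≡0 ⟩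
  f zero + 0ℚ                                    ≡⟨ +-identityʳ (f zero) ⟩
  f zero                                         ∎
  where
  rest≡0 : sumFin k (λ x → 0ℚ * f (suc x)) ≡ 0ℚ
  rest≡0 = trans (sum-cong (sumFin-linear k) (λ x → *-zeroˡ (f (suc x)))) (sum-0 (sumFin-linear k))
sumFin-δ (suc k) (suc j) f = begin
  0ℚ * f zero + sumFin k (λ x → ind (eqF (suc j) (suc x)) * f (suc x))
    ≡⟨ cong₂ _+_ (*-zeroˡ (f zero))
                 (sum-cong (sumFin-linear k) (λ x → cong (λ b → ind b * f (suc x)) (eqF-suc j x))) ⟩
  0ℚ + sumFin k (λ x → ind (eqF j x) * f (suc x))
    ≡⟨ +-identityˡ _ ⟩
  sumFin k (λ x → ind (eqF j x) * f (suc x))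
    ≡⟨ sumFin-δ k j (λ x → f (suc x)) ⟩
  f (suc j) ∎

countFin-cong : ∀ k {f g : Fin k → Bool} → (∀ i → f i ≡ g i) → countFin k f ≡ countFin k g
countFin-cong zero    f≗g = refl
countFin-cong (suc k) f≗g =
  cong₂ (λ b r → (if b then 1 else 0) ℕ.+ r) (f≗g zero) (countFin-cong k (λ i → f≗g (suc i)))

countFin-remove : ∀ k (f : Fin k → Bool) (a : Fin k) → T (f a) →
  suc (countFin k (λ v → f v ∧ not (eqF v a))) ≡ countFin k f
countFin-remove (suc k) f zero fa with f zero
... | true = cong suc (countFin-cong k (λ i → ∧-identityʳ (f (suc i))))
countFin-remove (suc k) f (suc a) fa = begin
  suc (bit (f zero ∧ true) ℕ.+ rest)  ≡⟨ cong (λ b → suc (bit b ℕ.+ rest)) (∧-identityʳ (f zero)) ⟩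
  suc (bit (f zero) ℕ.+ rest)         ≡⟨ sym (+-suc (bit (f zero)) rest) ⟩
  bit (f zero) ℕ.+ suc rest           ≡⟨ cong (bit (f zero) ℕ.+_) (trans (cong suc rest≡) (countFin-remove k (λ i → f (suc i)) a fa)) ⟩
  bit (f zero) ℕ.+ countFin k (λ i → f (suc i)) ∎
  where
  bit : Bool → ℕ
  bit b = if b then 1 else 0
  rest = countFin k (λ i → f (suc i) ∧ not (eqF (suc i) (suc a)))
  rest≡ : rest ≡ countFin k (λ i → f (suc i) ∧ not (eqF i a))
  rest≡ = countFin-cong k (λ i → cong (λ b → f (suc i) ∧ not b) (eqF-suc i a))

sumFin-ind : ∀ k (f : Fin k → Bool) → sumFin k (λ v → ind (f v)) ≡ fromℕ (countFin k f)
sumFin-ind zero    f = refl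
sumFin-ind (suc k) f =
  trans (cong₂ _+_ (ind≡fromℕ (f zero)) (sumFin-ind k (λ i → f (suc i))))
        (sym (fromℕ-+ (if f zero then 1 else 0) _))
  where
  ind≡fromℕ : ∀ b → ind b ≡ fromℕ (if b then 1 else 0)
  ind≡fromℕ true  = refl
  ind≡fromℕ false = refl

module NonBacktracking {n : ℕ} (G : Graph n) where
  open Graph G
  open GraphMatrices G

  sumOut : (i : Fin n) → (Σ[ j ∈ Fin n ] T (adj i j) → ℚ) → ℚ
  sumOut i = nestedSum (sumFin n) (λ j → sumIf (adj i j)) _,_

  sumÊ-linear : Linear sumÊ
  sumÊ-linear = nestedSum-linear {τ = sumOut} _,_ (sumFin-linear n)
    (λ i → nestedSum-linear _,_ (sumFin-linear n) (λ j → sumIf-linear (adj i j)))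

  sumÊ-interchange : Interchangeable sumÊ
  sumÊ-interchange = nestedSum-interchange {τ = sumOut} _,_ (sumFin-linear n) (sumFin-interchange n)
    (λ i → nestedSum-interchange {τ = λ j → sumIf (adj i j)} _,_ (sumFin-linear n) (sumFin-interchange n)
      (λ j → sumIf-interchange (adj i j)))

  ·E-assoc : ∀ {A D : Set} (M : Mat A Ê) (N : Mat Ê Ê) (L : Mat Ê D) →
    ∀ a d → ((M ·E N) ·E L) a d ≡ (M ·E (N ·E L)) a d
  ·E-assoc = product-assoc sumÊ-linear sumÊ-linear sumÊ-interchange

  sumÊ-leaving : ∀ x (F : Ê → ℚ) →
    sumÊ (λ e → ind (eqF x (src e)) * F e) ≡ sumFin n (λ y → sumIf (adj x y) (λ p → F (x , y , p)))
  sumÊ-leaving x F = begin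
    sumÊ (λ e → ind (eqF x (src e)) * F e)
      ≡⟨ sum-cong Lₙ (λ i → trans (sum-cong Lₙ (λ j → sum-*ˡ (sumIf-linear (adj i j)) (ind (eqF x i)) _))
                                      (sum-*ˡ Lₙ (ind (eqF x i)) _)) ⟩
    sumFin n (λ i → ind (eqF x i) * sumFin n (λ y → sumIf (adj i y) (λ p → F (i , y , p))))
      ≡⟨ sumFin-δ n x _ ⟩
    sumFin n (λ y → sumIf (adj x y) (λ p → F (x , y , p))) ∎
    where Lₙ = sumFin-linear n

  sumÊ-δ : ∀ a b (p : T (adj a b)) (F : Ê → ℚ) →
    sumÊ (λ g → ind (eqF a (src g)) * (ind (eqF b (tgt g)) * F g)) ≡ F (a , b , p)
  sumÊ-δ a b p F = begin
    sumÊ (λ g → ind (eqF a (src g)) * (ind (eqF b (tgt g)) * F g))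
      ≡⟨ sumÊ-leaving a _ ⟩
    sumFin n (λ y → sumIf (adj a y) (λ q → ind (eqF b y) * F (a , y , q)))
      ≡⟨ sum-cong (sumFin-linear n) (λ y → sum-*ˡ (sumIf-linear (adj a y)) (ind (eqF b y)) _) ⟩
    sumFin n (λ y → ind (eqF b y) * sumIf (adj a y) (λ q → F (a , y , q)))
      ≡⟨ sumFin-δ n b _ ⟩
    sumIf (adj a b) (λ q → F (a , b , q))
      ≡⟨ sumIf-at (adj a b) p _ ⟩
    F (a , b , p) ∎

  IÊ-identityˡ : ∀ {C : Set} (M : Mat Ê C) e c → (IÊ ·E M) e c ≡ M e c
  IÊ-identityˡ M (a , b , p) c = trans (sum-cong sumÊ-linear split) (sumÊ-δ a b p (λ g → M g c))
    where
    split : ∀ g → IÊ (a , b , p) g * M g c ≡ ind (eqF a (src g)) * (ind (eqF b (tgt g)) * M g c)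
    split g = trans (cong (_* M g c) (ind-∧ (eqF a (src g)) (eqF b (tgt g))))
                    (*-assoc (ind (eqF a (src g))) (ind (eqF b (tgt g))) (M g c))

  IÊ-identityʳ : ∀ {A : Set} (M : Mat A Ê) x e → (M ·E IÊ) x e ≡ M x e
  IÊ-identityʳ M x (a , b , p) = trans (sum-cong sumÊ-linear split) (sumÊ-δ a b p (M x))
    where
    split : ∀ g → M x g * IÊ g (a , b , p) ≡ ind (eqF a (src g)) * (ind (eqF b (tgt g)) * M x g)
    split g = begin
      M x g * ind (eqF (src g) a ∧ eqF (tgt g) b)          ≡⟨ *-comm (M x g) _ ⟩
      ind (eqF (src g) a ∧ eqF (tgt g) b) * M x g          ≡⟨ cong₂ (λ u v → ind (u ∧ v) * M x g) (eqF-sym (src g) a) (eqF-sym (tgt g) b) ⟩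
      ind (eqF a (src g) ∧ eqF b (tgt g)) * M x g          ≡⟨ cong (_* M x g) (ind-∧ (eqF a (src g)) (eqF b (tgt g))) ⟩
      ind (eqF a (src g)) * ind (eqF b (tgt g)) * M x g    ≡⟨ *-assoc (ind (eqF a (src g))) _ _ ⟩
      ind (eqF a (src g)) * (ind (eqF b (tgt g)) * M x g)  ∎

  Pnb^-suc : ∀ k e f → Pnb^ (suc k) e f ≡ (Pnb ·E Pnb^ k) e f
  Pnb^-suc zero    e f = trans (IÊ-identityˡ Pnb e f) (sym (IÊ-identityʳ Pnb e f))
  Pnb^-suc (suc k) e f =
    trans (sum-cong sumÊ-linear (λ g → cong (_* Pnb g f) (Pnb^-suc k e g)))
          (·E-assoc Pnb (Pnb^ k) Pnb e f)

  Tm-·E : ∀ {C : Set} (N : Mat Ê C) x c →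
    (Tm ·E N) x c ≡ sumFin n (λ y → sumIf (adj x y) (λ q → N (x , y , q) c))
  Tm-·E N x c =
    trans (sum-cong sumÊ-linear (λ e → cong (λ b → ind b * N e c) (eqF-sym (src e) x)))
          (sumÊ-leaving x (λ e → N e c))

  Pnb-·E : ∀ {C : Set} (N : Mat Ê C) a b (p : T (adj a b)) c →
    (Pnb ·E N) (a , b , p) c
      ≡ sumFin n (λ y → sumIf (adj b y) (λ q → ind (not (eqF y a)) * (inv (deg b ∸ 1) * N (b , y , q) c)))
  Pnb-·E N a b p c = trans (sum-cong sumÊ-linear split) (sumÊ-leaving b _)
    where
    split : ∀ h → Pnb (a , b , p) h * N h c
                ≡ ind (eqF b (src h)) * (ind (not (eqF (tgt h) a)) * (inv (deg b ∸ 1) * N h c))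
    split h = begin
      ind (u ∧ v) * w * N h c      ≡⟨ cong (λ z → z * w * N h c) (ind-∧ u v) ⟩
      ind u * ind v * w * N h c    ≡⟨ *-assoc (ind u * ind v) w (N h c) ⟩
      ind u * ind v * (w * N h c)  ≡⟨ *-assoc (ind u) (ind v) _ ⟩
      ind u * (ind v * (w * N h c)) ∎
      where
      u = eqF b (src h)
      v = not (eqF (tgt h) a)
      w = inv (deg b ∸ 1)

  Dinv-·V : ∀ (X : Mat (Fin n) (Fin n)) i j → (Dinv ·V X) i j ≡ inv (deg i) * X i j
  Dinv-·V X i j =
    trans (sum-cong (sumFin-linear n) (λ x → *-assoc (ind (eqF i x)) (inv (deg i)) (X x j)))
          (sumFin-δ n i (λ x → inv (deg i) * X x j))

  -- reachProb k a b j = P(X̃ₜ₊ₖ = j ∣ X̃ₜ₋₁ = a , X̃ₜ = b)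
  reachProb : ℕ → Fin n → Fin n → Fin n → ℚ
  reachProb k a b j = sumVec n k (λ xs → ind (eqF (last (b ∷ xs)) j) * nbProb a b xs)

  reachProb-scale : ∀ k K a b j →
    sumVec n k (λ xs → ind (eqF (last (b ∷ xs)) j) * (K * nbProb a b xs)) ≡ K * reachProb k a b j
  reachProb-scale k K a b j =
    trans (sum-cong (sumVec-linear n k) (λ xs → x∙yz≈y∙xz (ind (eqF (last (b ∷ xs)) j)) K _))
          (sum-*ˡ (sumVec-linear n k) K _)

  reachProb-Pnb^ : ∀ k a b (p : T (adj a b)) j → reachProb k a b j ≡ (Pnb^ k ·E S) (a , b , p) j
  reachProb-Pnb^ zero    a b p j = trans (*-identityʳ _) (sym (IÊ-identityˡ S (a , b , p) j))
  reachProb-Pnb^ (suc k) a b p j = begin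
    reachProb (suc k) a b j
      ≡⟨ sum-cong (sumFin-linear n) (λ y → reachProb-scale k (ind (nb y) * c) b y j) ⟩
    sumFin n (λ y → ind (nb y) * c * reachProb k b y j)
      ≡⟨ sum-cong (sumFin-linear n) (λ y → sym (first-step y)) ⟩
    sumFin n (λ y → sumIf (adj b y) (λ q → ind (not (eqF y a)) * (c * (Pnb^ k ·E S) (b , y , q) j)))
      ≡⟨ sym (Pnb-·E (Pnb^ k ·E S) a b p j) ⟩
    (Pnb ·E (Pnb^ k ·E S)) (a , b , p) j
      ≡⟨ sym (·E-assoc Pnb (Pnb^ k) S (a , b , p) j) ⟩
    ((Pnb ·E Pnb^ k) ·E S) (a , b , p) j
      ≡⟨ sum-cong sumÊ-linear (λ g → cong (_* S g j) (sym (Pnb^-suc k (a , b , p) g))) ⟩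
    (Pnb^ (suc k) ·E S) (a , b , p) j ∎
    where
    c = inv (deg b ∸ 1)
    nb : Fin n → Bool
    nb y = adj b y ∧ not (eqF y a)
    first-step : ∀ y → sumIf (adj b y) (λ q → ind (not (eqF y a)) * (c * (Pnb^ k ·E S) (b , y , q) j))
                     ≡ ind (nb y) * c * reachProb k b y j
    first-step y =
      trans (sum-cong (sumIf-linear (adj b y))
                      (λ q → cong (λ z → ind (not (eqF y a)) * (c * z)) (sym (reachProb-Pnb^ k b y q j))))
            (sumIf-weight (adj b y) (not (eqF y a)) c (reachProb k b y j))

  P̃-suc-reachProb : ∀ k i j →
    P̃ (suc k) i j ≡ inv (deg i) * sumFin n (λ y → ind (adj i y) * reachProb k i y j)
  P̃-suc-reachProb k i j =
    trans (sum-cong Lₙ (λ y → trans (reachProb-scale k (ind (adj i y) * d) i y j)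
                                    (*-assoc (ind (adj i y)) d _)))
          (trans (sum-cong Lₙ (λ y → x∙yz≈y∙xz (ind (adj i y)) d _)) (sum-*ˡ Lₙ d _))
    where
    Lₙ = sumFin-linear n
    d = inv (deg i)

  TPnb^S-reachProb : ∀ k x j →
    ((Tm ·E Pnb^ k) ·E S) x j ≡ sumFin n (λ y → ind (adj x y) * reachProb k x y j)
  TPnb^S-reachProb k x j = begin
    ((Tm ·E Pnb^ k) ·E S) x j
      ≡⟨ ·E-assoc Tm (Pnb^ k) S x j ⟩
    (Tm ·E (Pnb^ k ·E S)) x j
      ≡⟨ Tm-·E (Pnb^ k ·E S) x j ⟩
    sumFin n (λ y → sumIf (adj x y) (λ q → (Pnb^ k ·E S) (x , y , q) j))
      ≡⟨ sum-cong (sumFin-linear n) (λ y →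
           trans (sum-cong (sumIf-linear (adj x y)) (λ q → sym (reachProb-Pnb^ k x y q j)))
                 (sumIf-const (adj x y) _)) ⟩
    sumFin n (λ y → ind (adj x y) * reachProb k x y j) ∎


  Pnb-Tᵀ≡S : (∀ i → 2 ≤ deg i) → ∀ e x → (Pnb ·E Tᵀ) e x ≡ S e x
  Pnb-Tᵀ≡S deg≥2 (a , b , p) x = begin
    (Pnb ·E Tᵀ) (a , b , p) x
      ≡⟨ Pnb-·E Tᵀ a b p x ⟩
    sumFin n (λ y → sumIf (adj b y) (λ _ → ind (not (eqF y a)) * (c * w)))
      ≡⟨ sum-cong Lₙ (λ y → sumIf-weight (adj b y) (not (eqF y a)) c w) ⟩
    sumFin n (λ y → ind (nb y) * c * w)
      ≡⟨ sum-*ʳ Lₙ w _ ⟩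
    sumFin n (λ y → ind (nb y) * c) * w
      ≡⟨ cong (_* w) (sum-*ʳ Lₙ c _) ⟩
    sumFin n (λ y → ind (nb y)) * c * w
      ≡⟨ cong (λ z → z * c * w) (trans (sumFin-ind n nb) (cong fromℕ count-nb)) ⟩
    fromℕ (deg b ∸ 1) * c * w
      ≡⟨ cong (_* w) (fromℕ-pred-*-inv (deg≥2 b)) ⟩
    1ℚ * w
      ≡⟨ *-identityˡ w ⟩
    w ∎
    where
    Lₙ = sumFin-linear n
    c = inv (deg b ∸ 1)
    w = ind (eqF b x)
    nb : Fin n → Bool
    nb y = adj b y ∧ not (eqF y a)
    count-nb : countFin n nb ≡ deg b ∸ 1
    count-nb = cong (_∸ 1) (countFin-remove n (adj b) a (subst T (symm a b) p))

  TPnb^S≡TPnb^⁺Tᵀ : (∀ i → 2 ≤ deg i) → ∀ k x j →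
    ((Tm ·E Pnb^ k) ·E S) x j ≡ ((Tm ·E Pnb^ (suc k)) ·E Tᵀ) x j
  TPnb^S≡TPnb^⁺Tᵀ deg≥2 k x j = begin
    ((Tm ·E Pnb^ k) ·E S) x j              ≡⟨ ·E-assoc Tm (Pnb^ k) S x j ⟩
    (Tm ·E (Pnb^ k ·E S)) x j              ≡⟨ sum-cong sumÊ-linear (λ e → cong (Tm x e *_) (sym (Pnb^⁺-Tᵀ e))) ⟩
    (Tm ·E (Pnb^ (suc k) ·E Tᵀ)) x j       ≡⟨ sym (·E-assoc Tm (Pnb^ (suc k)) Tᵀ x j) ⟩
    ((Tm ·E Pnb^ (suc k)) ·E Tᵀ) x j       ∎
    where
    Pnb^⁺-Tᵀ : ∀ e → (Pnb^ (suc k) ·E Tᵀ) e j ≡ (Pnb^ k ·E S) e j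
    Pnb^⁺-Tᵀ e = trans (·E-assoc (Pnb^ k) Pnb Tᵀ e j)
                       (sum-cong sumÊ-linear (λ h → cong (Pnb^ k e h *_) (Pnb-Tᵀ≡S deg≥2 h j)))

mainTheorem1 : (n : ℕ) (G : Graph n) → Connected G
    → (∀ i → 2 ≤ GraphMatrices.deg G i)
    → (k : ℕ) → ∀ i j
    → (GraphMatrices.P̃ G (ℕ.suc k) i j
         ≡ GraphMatrices._·V_ G (GraphMatrices.Dinv G)
             (GraphMatrices._·E_ G (GraphMatrices._·E_ G (GraphMatrices.Tm G) (GraphMatrices.Pnb^ G k)) (GraphMatrices.S G)) i j)
      × (GraphMatrices._·V_ G (GraphMatrices.Dinv G)
             (GraphMatrices._·E_ G (GraphMatrices._·E_ G (GraphMatrices.Tm G) (GraphMatrices.Pnb^ G k)) (GraphMatrices.S G)) i j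
         ≡ GraphMatrices._·V_ G (GraphMatrices.Dinv G)
             (GraphMatrices._·E_ G (GraphMatrices._·E_ G (GraphMatrices.Tm G) (GraphMatrices.Pnb^ G (ℕ.suc k))) (GraphMatrices.Tᵀ G)) i j)
mainTheorem1 n G _ deg≥2 k i j = walk-law , edge-form
  where
  open Graph G using (adj)
  open GraphMatrices G
  open NonBacktracking G

  walk-law : P̃ (suc k) i j ≡ (Dinv ·V ((Tm ·E Pnb^ k) ·E S)) i j
  walk-law = begin
    P̃ (suc k) i j
      ≡⟨ P̃-suc-reachProb k i j ⟩
    inv (deg i) * sumFin n (λ y → ind (adj i y) * reachProb k i y j)
      ≡⟨ cong (inv (deg i) *_) (sym (TPnb^S-reachProb k i j)) ⟩
    inv (deg i) * ((Tm ·E Pnb^ k) ·E S) i j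
      ≡⟨ sym (Dinv-·V ((Tm ·E Pnb^ k) ·E S) i j) ⟩
    (Dinv ·V ((Tm ·E Pnb^ k) ·E S)) i j ∎

  edge-form : (Dinv ·V ((Tm ·E Pnb^ k) ·E S)) i j ≡ (Dinv ·V ((Tm ·E Pnb^ (suc k)) ·E Tᵀ)) i j
  edge-form = begin
    (Dinv ·V ((Tm ·E Pnb^ k) ·E S)) i j
      ≡⟨ Dinv-·V ((Tm ·E Pnb^ k) ·E S) i j ⟩
    inv (deg i) * ((Tm ·E Pnb^ k) ·E S) i j
      ≡⟨ cong (inv (deg i) *_) (TPnb^S≡TPnb^⁺Tᵀ deg≥2 k i j) ⟩
    inv (deg i) * ((Tm ·E Pnb^ (suc k)) ·E Tᵀ) i j
      ≡⟨ sym (Dinv-·V ((Tm ·E Pnb^ (suc k)) ·E Tᵀ) i j) ⟩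
    (Dinv ·V ((Tm ·E Pnb^ (suc k)) ·E Tᵀ)) i j ∎
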